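{- Let $k\in\mathbb{N}$, let $u$ be an infinite word over $\Sigma$, and let $\tau$ be the $\mathrm{prefFO}$ $k$-type of $u$. Then there exists $n\in\mathbb{N}$ such that for all $m>n$, the finite word $u[0\dots m]$ also has $\mathrm{prefFO}$ $k$-type $\tau$.
   Context: $\Sigma$ is a finite alphabet; $u[0\dots m]$ denotes the prefix of $u$ consisting of positions $0$ to $m$. Prefix first-order logic on words ($\mathrm{prefFO}$): first-order logic over (finite or infinite) words on $\Sigma$ with the order $<$ on positions and a unary predicate for each letter, restricted to sentences which start with a quantification (existential or universal) of a variable $\bar x$, after which every further quantification is of the form $\exists x<\bar x$ or $\forall x<\bar x$ (together with Boolean combinations of such sentences). The $\mathrm{prefFO}$ $k$-type of a word $w$ is the set of all $\mathrm{prefFO}$ sentences of quantifier depth at most $k$ satisfied by $w$. -}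

module Defs where

open import Data.Nat using (ℕ; zero; suc; _<_; _⊔_)
open import Data.Fin using (Fin)
open import Data.List using (List; []; _∷_; length; map; upTo)
open import Data.Maybe using (Maybe; just; nothing)
open import Data.Product using (Σ; _×_; _,_)
open import Data.Sum using (_⊎_)
open import Data.Unit using (⊤)
open import Relation.Nullary using (¬_)
open import Relation.Binary.PropositionalEquality using (_≡_)

Alphabet : ℕ → Set
Alphabet s = Fin s

data Word (s : ℕ) : Set where
  fin : List (Alphabet s) → Word s
  inf : (ℕ → Alphabet s) → Word s

_!?_ : {A : Set} → List A → ℕ → Maybe A
[] !? _ = nothing
(x ∷ xs) !? zero = just x
(x ∷ xs) !? suc i = xs !? i

InDom : {s : ℕ} → Word s → ℕ → Set
InDom (fin l) i = i < length l
InDom (inf u) i = ⊤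

HasLetter : {s : ℕ} → Word s → Alphabet s → ℕ → Set
HasLetter (fin l) a i = l !? i ≡ just a
HasLetter (inf u) a i = u i ≡ a

-- prefix u[0…m] : the finite word u 0 u 1 … u m (length m+1)
prefix : {s : ℕ} → (ℕ → Alphabet s) → ℕ → Word s
prefix u m = fin (map u (upTo (suc m)))

-- Terms inside the scope of the outer variable x̄, with n further
-- (bounded) variables in scope (de Bruijn indices).
data Tm (n : ℕ) : Set where
  xbar : Tm n
  var  : Fin n → Tm n

-- Bounded formulas: every quantifier is of the form ∃x<x̄ / ∀x<x̄.
data Fm (s : ℕ) (n : ℕ) : Set where
  lt   : Tm n → Tm n → Fm s n
  eq   : Tm n → Tm n → Fm s n
  P    : Alphabet s → Tm n → Fm s n
  neg  : Fm s n → Fm s n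
  and  : Fm s n → Fm s n → Fm s n
  or   : Fm s n → Fm s n → Fm s n
  exB  : Fm s (suc n) → Fm s n
  allB : Fm s (suc n) → Fm s n

-- prefFO sentences: ∃x̄ φ, ∀x̄ φ, and Boolean combinations thereof.
data Sent (s : ℕ) : Set where
  ex   : Fm s 0 → Sent s
  all  : Fm s 0 → Sent s
  neg  : Sent s → Sent s
  and  : Sent s → Sent s → Sent s
  or   : Sent s → Sent s → Sent s

depthF : {s n : ℕ} → Fm s n → ℕ
depthF (lt _ _) = 0
depthF (eq _ _) = 0
depthF (P _ _) = 0
depthF (neg φ) = depthF φ
depthF (and φ ψ) = depthF φ ⊔ depthF ψ
depthF (or φ ψ) = depthF φ ⊔ depthF ψ
depthF (exB φ) = suc (depthF φ)
depthF (allB φ) = suc (depthF φ)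

depth : {s : ℕ} → Sent s → ℕ
depth (ex φ) = suc (depthF φ)
depth (all φ) = suc (depthF φ)
depth (neg φ) = depth φ
depth (and φ ψ) = depth φ ⊔ depth ψ
depth (or φ ψ) = depth φ ⊔ depth ψ

Env : ℕ → Set
Env n = Fin n → ℕ

extend : {n : ℕ} → ℕ → Env n → Env (suc n)
extend i ρ Fin.zero = i
extend i ρ (Fin.suc j) = ρ j

evalT : {n : ℕ} → ℕ → Env n → Tm n → ℕ
evalT x ρ xbar = x
evalT x ρ (var j) = ρ j

SatF : {s n : ℕ} → Word s → ℕ → Env n → Fm s n → Set
SatF w x ρ (lt t t') = evalT x ρ t < evalT x ρ t'
SatF w x ρ (eq t t') = evalT x ρ t ≡ evalT x ρ t'
SatF w x ρ (P a t) = HasLetter w a (evalT x ρ t)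
SatF w x ρ (neg φ) = ¬ SatF w x ρ φ
SatF w x ρ (and φ ψ) = SatF w x ρ φ × SatF w x ρ ψ
SatF w x ρ (or φ ψ) = SatF w x ρ φ ⊎ SatF w x ρ ψ
SatF w x ρ (exB φ) = Σ ℕ λ i → i < x × SatF w x (extend i ρ) φ
SatF w x ρ (allB φ) = (i : ℕ) → i < x → SatF w x (extend i ρ) φ

noEnv : Env 0
noEnv ()

Sat : {s : ℕ} → Word s → Sent s → Set
Sat w (ex φ) = Σ ℕ λ x → InDom w x × SatF w x noEnv φ
Sat w (all φ) = (x : ℕ) → InDom w x → SatF w x noEnv φ
Sat w (neg φ) = ¬ Sat w φ
Sat w (and φ ψ) = Sat w φ × Sat w ψ
Sat w (or φ ψ) = Sat w φ ⊎ Sat w ψ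

SameType : {s : ℕ} → ℕ → Word s → Word s → Set
SameType k w v = (φ : Sent _) → depth φ Data.Nat.≤ k → (Sat w φ → Sat v φ) × (Sat v φ → Sat w φ)

module Submission where

-- Whether a bounded formula of depth ≤ k holds at x̄ = x (under an
-- assignment ρ) is determined by a finite "code" of (x, ρ): the truth values of
-- the atomic formulas, together with, for each level-(k-1) code c of one more
-- variable, whether some i < x realises c.  There are finitely many codes, so
-- there is an N such that every level-k code realised by a position of u is
-- realised by one below N.  For m > N the prefix u[0…m] has the same k-type as
-- u: a bounded formula at x̄ = x only reads letters at positions ≤ x, so it
-- holds in u[0…m] iff it holds in u as long as x ≤ m, and any position of u
-- can be traded for one ≤ N with the same code.

open import Defs
open import Data.Nat using (ℕ; _<_)
open import Data.Fin using (Fin)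
open import Data.Product using (Σ)
open import Axiom.ExcludedMiddle using (ExcludedMiddle)
open import Level using (0ℓ)

open import Data.Nat using (zero; suc; _≤_; _⊔_; s≤s)
open import Data.Nat.Properties
  using (≤-refl; ≤-trans; <⇒≤; m<1+n⇒m≤n; m≤m⊔n; m≤n⊔m; m⊔n≤o⇒m≤o; m⊔n≤o⇒n≤o)
open import Data.Bool using (Bool; true; false)
open import Data.List
  using (List; []; _∷_; [_]; _++_; map; length; allFin; applyUpTo; upTo; cartesianProduct; cartesianProductWith)
open import Data.List.Properties using (length-map; map-applyUpTo; length-upTo; ∷-injective)
open import Data.List.Membership.Propositional using (_∈_)
open import Data.List.Membership.Propositional.Properties
  using (∈-map⁺; ∈-++⁺ˡ; ∈-++⁺ʳ; ∈-allFin; ∈-cartesianProduct⁺; ∈-cartesianProductWith⁺)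
open import Data.List.Relation.Unary.Any using (here; there)
open import Data.Maybe using (just)
open import Data.Maybe.Properties using (just-injective)
open import Data.Product using (_×_; _,_; proj₁; proj₂; ∃-syntax) renaming (map to map-×)
open import Data.Sum using () renaming (map to map-⊎)
open import Data.Sum.Function.Propositional using (_⊎-⇔_)
open import Data.Product.Function.NonDependent.Propositional using (_×-⇔_)
open import Data.Unit using (tt)
open import Function.Bundles using (_⇔_; mk⇔; Equivalence)
open import Function.Construct.Identity using (⇔-id)
open import Function.Related.TypeIsomorphisms using (¬-cong-⇔)
open import Relation.Nullary using (Dec; yes; no; does; contradiction)
open import Relation.Binary.PropositionalEquality using (_≡_; refl; sym; trans; cong; subst)

open Equivalence using (to; from)

boolLists : ℕ → List (List Bool)
boolLists zero = [ [] ]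
boolLists (suc n) = map (true ∷_) (boolLists n) ++ map (false ∷_) (boolLists n)

∈-boolLists : ∀ {n} (bs : List Bool) → length bs ≡ n → bs ∈ boolLists n
∈-boolLists [] refl = here refl
∈-boolLists (true ∷ bs) refl = ∈-++⁺ˡ (∈-map⁺ (true ∷_) (∈-boolLists bs refl))
∈-boolLists (false ∷ bs) refl = ∈-++⁺ʳ _ (∈-map⁺ (false ∷_) (∈-boolLists bs refl))

map-≡⇒≡-on : ∀ {A B : Set} {f g : A → B} {xs : List A} {a : A} →
             map f xs ≡ map g xs → a ∈ xs → f a ≡ g a
map-≡⇒≡-on fxs≡gxs (here refl) = proj₁ (∷-injective fxs≡gxs)
map-≡⇒≡-on fxs≡gxs (there a∈xs) = map-≡⇒≡-on (proj₂ (∷-injective fxs≡gxs)) a∈xs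

applyUpTo-!? : ∀ {A : Set} (f : ℕ → A) {n i : ℕ} → i < n → applyUpTo f n !? i ≡ just (f i)
applyUpTo-!? f {suc n} {zero} _ = refl
applyUpTo-!? f {suc n} {suc i} (s≤s i<n) = applyUpTo-!? (λ j → f (suc j)) i<n

does-≡⇒→ : ∀ {A B : Set} (a? : Dec A) (b? : Dec B) → does a? ≡ does b? → A → B
does-≡⇒→ _ (yes b) _ _ = b
does-≡⇒→ (yes _) (no _) () _
does-≡⇒→ (no ¬a) (no _) _ a = contradiction a ¬a

module _ (lem : ExcludedMiddle 0ℓ) {A : Set} (f : ℕ → A) where

  realised-below : (E : List A) →
    ∃[ N ] ∀ {a} → a ∈ E → ∃[ x ] f x ≡ a → ∃[ y ] y ≤ N × f y ≡ a
  realised-below [] = 0 , λ ()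
  realised-below (a ∷ E) with realised-below E | lem {∃[ x ] f x ≡ a}
  ... | N , below | yes (x , fx≡a) = x ⊔ N , below′
    where
      below′ : ∀ {b} → b ∈ a ∷ E → ∃[ x ] f x ≡ b → ∃[ y ] y ≤ x ⊔ N × f y ≡ b
      below′ (here refl) _ = x , m≤m⊔n x N , fx≡a
      below′ (there b∈E) r with below b∈E r
      ... | y , y≤N , fy≡b = y , ≤-trans y≤N (m≤n⊔m x N) , fy≡b
  ... | N , below | no ¬r = N , below′
    where
      below′ : ∀ {b} → b ∈ a ∷ E → ∃[ x ] f x ≡ b → ∃[ y ] y ≤ N × f y ≡ b
      below′ (here refl) r = contradiction r ¬r
      below′ (there b∈E) r = below b∈E r

  finite-image-representatives : (E : List A) → (∀ x → f x ∈ E) →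
    ∃[ N ] ∀ x → ∃[ y ] y ≤ N × f y ≡ f x
  finite-image-representatives E f∈E with realised-below E
  ... | N , below = N , λ x → below (f∈E x) (x , refl)

module _ {s : ℕ} {w w′ : Word s} {x : ℕ}
         (agree : ∀ a i → i ≤ x → HasLetter w a i ⇔ HasLetter w′ a i) where

  evalT-≤ : ∀ {n} {ρ : Env n} → (∀ j → ρ j ≤ x) → (t : Tm n) → evalT x ρ t ≤ x
  evalT-≤ ρ≤x xbar = ≤-refl
  evalT-≤ ρ≤x (var j) = ρ≤x j

  extend-≤ : ∀ {n i} {ρ : Env n} → i < x → (∀ j → ρ j ≤ x) → ∀ j → extend i ρ j ≤ x
  extend-≤ i<x ρ≤x Fin.zero = <⇒≤ i<x
  extend-≤ i<x ρ≤x (Fin.suc j) = ρ≤x j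

  satF-local : ∀ {n} {ρ : Env n} → (∀ j → ρ j ≤ x) →
               (φ : Fm s n) → SatF w x ρ φ ⇔ SatF w′ x ρ φ
  satF-local ρ≤x (lt t t′) = ⇔-id _
  satF-local ρ≤x (eq t t′) = ⇔-id _
  satF-local ρ≤x (P a t) = agree a _ (evalT-≤ ρ≤x t)
  satF-local ρ≤x (neg φ) = ¬-cong-⇔ (satF-local ρ≤x φ)
  satF-local ρ≤x (and φ ψ) = satF-local ρ≤x φ ×-⇔ satF-local ρ≤x ψ
  satF-local ρ≤x (or φ ψ) = satF-local ρ≤x φ ⊎-⇔ satF-local ρ≤x ψ
  satF-local ρ≤x (exB φ) = mk⇔
    (λ (i , i<x , sat) → i , i<x , to (satF-local (extend-≤ i<x ρ≤x) φ) sat)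
    (λ (i , i<x , sat) → i , i<x , from (satF-local (extend-≤ i<x ρ≤x) φ) sat)
  satF-local ρ≤x (allB φ) = mk⇔
    (λ sat i i<x → to (satF-local (extend-≤ i<x ρ≤x) φ) (sat i i<x))
    (λ sat i i<x → from (satF-local (extend-≤ i<x ρ≤x) φ) (sat i i<x))

module _ {s : ℕ} (u : ℕ → Alphabet s) (m : ℕ) where

  inDom-prefix : ∀ {i} → InDom (prefix u m) i ⇔ i ≤ m
  inDom-prefix {i} = mk⇔
    (λ i<len → m<1+n⇒m≤n (subst (i <_) length-prefix i<len))
    (λ i≤m → subst (i <_) (sym length-prefix) (s≤s i≤m))
    where
      length-prefix : length (map u (upTo (suc m))) ≡ suc m
      length-prefix = trans (length-map u (upTo (suc m))) (length-upTo (suc m))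

  hasLetter-prefix : ∀ {a i} → i ≤ m → HasLetter (inf u) a i ⇔ HasLetter (prefix u m) a i
  hasLetter-prefix {a} {i} i≤m = mk⇔
    (λ ui≡a → trans prefix-!? (cong just ui≡a))
    (λ lookup≡a → just-injective (trans (sym prefix-!?) lookup≡a))
    where
      prefix-!? : map u (upTo (suc m)) !? i ≡ just (u i)
      prefix-!? = trans (cong (_!? i) (map-applyUpTo (λ j → j) u (suc m))) (applyUpTo-!? u (s≤s i≤m))

module Hintikka (lem : ExcludedMiddle 0ℓ) {s : ℕ} (w : Word s) where

  terms : (n : ℕ) → List (Tm n)
  terms n = xbar ∷ map var (allFin n)

  ∈-terms : ∀ {n} (t : Tm n) → t ∈ terms n
  ∈-terms xbar = here refl
  ∈-terms (var j) = there (∈-map⁺ var (∈-allFin j))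

  atoms : (n : ℕ) → List (Fm s n)
  atoms n = cartesianProductWith lt (terms n) (terms n)
         ++ cartesianProductWith eq (terms n) (terms n)
         ++ cartesianProductWith P (allFin s) (terms n)

  lt∈atoms : ∀ {n} (t t′ : Tm n) → lt t t′ ∈ atoms n
  lt∈atoms t t′ = ∈-++⁺ˡ (∈-cartesianProductWith⁺ lt (∈-terms t) (∈-terms t′))

  eq∈atoms : ∀ {n} (t t′ : Tm n) → eq t t′ ∈ atoms n
  eq∈atoms {n} t t′ = ∈-++⁺ʳ (cartesianProductWith lt (terms n) (terms n)) (∈-++⁺ˡ (∈-cartesianProductWith⁺ eq (∈-terms t) (∈-terms t′)))

  P∈atoms : ∀ {n} (a : Alphabet s) (t : Tm n) → P a t ∈ atoms n
  P∈atoms {n} a t =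
    ∈-++⁺ʳ (cartesianProductWith lt (terms n) (terms n))
      (∈-++⁺ʳ (cartesianProductWith eq (terms n) (terms n)) (∈-cartesianProductWith⁺ P (∈-allFin a) (∈-terms t)))

  truthValue : Set → Bool
  truthValue A = does (lem {A})

  truthValue-≡⇒→ : ∀ {A B} → truthValue A ≡ truthValue B → A → B
  truthValue-≡⇒→ = does-≡⇒→ lem lem

  Code : Set
  Code = List Bool × List Bool

  mutual
    realisedCount : ℕ → ℕ → ℕ
    realisedCount zero n = 0
    realisedCount (suc k) n = length (codes k (suc n))

    codes : ℕ → ℕ → List Code
    codes k n = cartesianProduct (boolLists (length (atoms n))) (boolLists (realisedCount k n))

  atomBits : ∀ {n} → ℕ → Env n → List Bool
  atomBits x ρ = map (λ α → truthValue (SatF w x ρ α)) (atoms _)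

  -- The level-(k+1) code of (x, ρ) has one bit per level-k code c of n+1
  -- variables, telling whether some i < x gives (x, extend i ρ) the code c.
  mutual
    code : ℕ → ∀ {n} → ℕ → Env n → Code
    code k x ρ = atomBits x ρ , realisedBits k x ρ

    realisedBits : ℕ → ∀ {n} → ℕ → Env n → List Bool
    realisedBits zero x ρ = []
    realisedBits (suc k) {n} x ρ = map (λ c → truthValue (Realised k x ρ c)) (codes k (suc n))

    Realised : ℕ → ∀ {n} → ℕ → Env n → Code → Set
    Realised k x ρ c = ∃[ i ] i < x × code k x (extend i ρ) ≡ c

  code∈codes : ∀ k {n} x (ρ : Env n) → code k x ρ ∈ codes k n
  code∈codes k {n} x ρ = ∈-cartesianProduct⁺
    (∈-boolLists _ (length-map _ (atoms n)))
    (∈-boolLists _ (length-realisedBits k))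
    where
      length-realisedBits : ∀ k → length (realisedBits k x ρ) ≡ realisedCount k n
      length-realisedBits zero = refl
      length-realisedBits (suc k) = length-map _ (codes k (suc n))

  atomBits-transfer : ∀ {n x x′} {ρ ρ′ : Env n} {α} → atomBits x ρ ≡ atomBits x′ ρ′ →
                      α ∈ atoms n → SatF w x ρ α → SatF w x′ ρ′ α
  atomBits-transfer bits≡ α∈atoms = truthValue-≡⇒→ (map-≡⇒≡-on bits≡ α∈atoms)

  realised-transfer : ∀ {k n x x′} {ρ ρ′ : Env n} {c} → code (suc k) x ρ ≡ code (suc k) x′ ρ′ →
                      Realised k x ρ c → Realised k x′ ρ′ c
  realised-transfer {k} {x = x} {ρ = ρ} code≡ r@(i , _ , refl) =
    truthValue-≡⇒→ (map-≡⇒≡-on (cong proj₂ code≡) (code∈codes k x (extend i ρ))) r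

  code-transfer : ∀ k {n x x′} {ρ ρ′ : Env n} → code k x ρ ≡ code k x′ ρ′ →
                  (φ : Fm s n) → depthF φ ≤ k → SatF w x ρ φ → SatF w x′ ρ′ φ
  code-transfer k code≡ (lt t t′) _ = atomBits-transfer (cong proj₁ code≡) (lt∈atoms t t′)
  code-transfer k code≡ (eq t t′) _ = atomBits-transfer (cong proj₁ code≡) (eq∈atoms t t′)
  code-transfer k code≡ (P a t) _ = atomBits-transfer (cong proj₁ code≡) (P∈atoms a t)
  code-transfer k code≡ (neg φ) d ¬sat sat′ = ¬sat (code-transfer k (sym code≡) φ d sat′)
  code-transfer k code≡ (and φ ψ) d = map-×
    (code-transfer k code≡ φ (m⊔n≤o⇒m≤o (depthF φ) (depthF ψ) d))
    (code-transfer k code≡ ψ (m⊔n≤o⇒n≤o (depthF φ) (depthF ψ) d))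
  code-transfer k code≡ (or φ ψ) d = map-⊎
    (code-transfer k code≡ φ (m⊔n≤o⇒m≤o (depthF φ) (depthF ψ) d))
    (code-transfer k code≡ ψ (m⊔n≤o⇒n≤o (depthF φ) (depthF ψ) d))
  code-transfer (suc k) code≡ (exB φ) (s≤s d) (i , i<x , sat)
    with realised-transfer {k} code≡ (i , i<x , refl)
  ... | i′ , i′<x′ , code≡′ = i′ , i′<x′ , code-transfer k (sym code≡′) φ d sat
  code-transfer (suc k) code≡ (allB φ) (s≤s d) sat i′ i′<x′
    with realised-transfer {k} (sym code≡) (i′ , i′<x′ , refl)
  ... | i , i<x , code≡′ = code-transfer k code≡′ φ d (sat i i<x)

module _ (lem : ExcludedMiddle 0ℓ) {s : ℕ} (u : ℕ → Alphabet s) (k m : ℕ) where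

  open Hintikka lem (inf u)

  satF-prefix : ∀ {y} → y ≤ m → (φ : Fm s 0) →
                SatF (inf u) y noEnv φ ⇔ SatF (prefix u m) y noEnv φ
  satF-prefix y≤m = satF-local (λ a i i≤y → hasLetter-prefix u m (≤-trans i≤y y≤m)) (λ ())

  sat-prefix : (∀ x → ∃[ y ] y ≤ m × code k y noEnv ≡ code k x noEnv) →
               (φ : Sent s) → depth φ ≤ k → Sat (inf u) φ ⇔ Sat (prefix u m) φ
  sat-prefix rep (ex φ) d = mk⇔ witness-below
    (λ (x , x∈ , sat) → x , tt , from (satF-prefix (to (inDom-prefix u m) x∈) φ) sat)
    where
      witness-below : Sat (inf u) (ex φ) → Sat (prefix u m) (ex φ)
      witness-below (x , _ , sat) with rep x
      ... | y , y≤m , code≡ = y , from (inDom-prefix u m) y≤m ,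
            to (satF-prefix y≤m φ) (code-transfer k (sym code≡) φ (<⇒≤ d) sat)
  sat-prefix rep (all φ) d = mk⇔
    (λ sat x x∈ → to (satF-prefix (to (inDom-prefix u m) x∈) φ) (sat x tt))
    everywhere
    where
      everywhere : Sat (prefix u m) (all φ) → Sat (inf u) (all φ)
      everywhere sat x _ with rep x
      ... | y , y≤m , code≡ = code-transfer k code≡ φ (<⇒≤ d)
            (from (satF-prefix y≤m φ) (sat y (from (inDom-prefix u m) y≤m)))
  sat-prefix rep (neg φ) d = ¬-cong-⇔ (sat-prefix rep φ d)
  sat-prefix rep (and φ ψ) d =
    sat-prefix rep φ (m⊔n≤o⇒m≤o (depth φ) (depth ψ) d)
      ×-⇔ sat-prefix rep ψ (m⊔n≤o⇒n≤o (depth φ) (depth ψ) d)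
  sat-prefix rep (or φ ψ) d =
    sat-prefix rep φ (m⊔n≤o⇒m≤o (depth φ) (depth ψ) d)
      ⊎-⇔ sat-prefix rep ψ (m⊔n≤o⇒n≤o (depth φ) (depth ψ) d)

corollary1 : ExcludedMiddle 0ℓ →
    (s : ℕ) (k : ℕ) (u : ℕ → Alphabet s) →
    Σ ℕ λ n → (m : ℕ) → n < m → SameType k (inf u) (prefix u m)
corollary1 lem s k u = N , λ m N<m φ d →
  let φ⇔ = sat-prefix lem u k m (representative-below m N<m) φ d in to φ⇔ , from φ⇔
  where
    open Hintikka lem (inf u)

    representatives : ∃[ N ] ∀ x → ∃[ y ] y ≤ N × code k y noEnv ≡ code k x noEnv
    representatives = finite-image-representatives lem (λ x → code k x noEnv) (codes k 0)
                        (λ x → code∈codes k x noEnv)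

    N : ℕ
    N = proj₁ representatives

    representative-below : ∀ m → N < m → ∀ x → ∃[ y ] y ≤ m × code k y noEnv ≡ code k x noEnv
    representative-below m N<m x with proj₂ representatives x
    ... | y , y≤N , code≡ = y , ≤-trans y≤N (<⇒≤ N<m) , code≡
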